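{- Let $G$ be a $2$-connected multigraph that admits an interval coloring. Then $W(G)\leq 1+\left\lfloor \frac{c(G)}{2}\right\rfloor(\Delta(G)-1)$, where $c(G)$ is the length of a longest cycle in $G$.
   Context: Multigraphs are finite and may have multiple edges but no loops. For a positive integer $t$, an interval $t$-coloring of a multigraph $G$ is a proper edge coloring $\alpha:E(G)\to\{1,\dots,t\}$ in which every color $1,\dots,t$ is used and, for every vertex $v$, the set of colors on the edges incident to $v$ is an interval of consecutive integers. For a multigraph $G$ having an interval coloring, $W(G)$ denotes the maximum $t$ such that $G$ has an interval $t$-coloring. $\Delta(G)$ is the maximum degree. -}

module Defs where

open import Data.Nat using (ℕ; zero; suc; _≤_; _⊔_; _+_; _%_)
open import Data.Nat.DivMod using (m%n<n)
open import Data.Fin using (Fin; toℕ; fromℕ<) renaming (_≟_ to _≟ᶠ_)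
open import Data.List using (List; foldr; map)
open import Data.Nat.ListAction using (sum)
open import Data.Empty using (⊥)
open import Data.List.Base using (allFin)
open import Data.Product using (Σ; ∃; _×_; _,_; proj₁; proj₂)
open import Data.Sum using (_⊎_)
open import Data.Bool using (if_then_else_; _∨_)
open import Data.Unit using (⊤)
open import Relation.Nullary using (¬_; does)
open import Relation.Binary.PropositionalEquality using (_≡_; _≢_)
open import Function.Definitions using (Injective)

record Multigraph : Set where
  field
    n     : ℕ
    m     : ℕ
    ends  : Fin m → Fin n × Fin n
    loopless : ∀ e → proj₁ (ends e) ≢ proj₂ (ends e)
open Multigraph public

Inc : (G : Multigraph) → Fin (n G) → Fin (m G) → Set
Inc G v e = proj₁ (ends G e) ≡ v ⊎ proj₂ (ends G e) ≡ v

Joins : (G : Multigraph) → Fin (m G) → Fin (n G) → Fin (n G) → Set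
Joins G e u w = ends G e ≡ (u , w) ⊎ ends G e ≡ (w , u)

deg : (G : Multigraph) → Fin (n G) → ℕ
deg G v = sum (map (λ e → if does (proj₁ (ends G e) ≟ᶠ v) ∨ does (proj₂ (ends G e) ≟ᶠ v)
                           then 1 else 0) (allFin (m G)))

maxDeg : Multigraph → ℕ
maxDeg G = foldr _⊔_ 0 (map (deg G) (allFin (n G)))

record IntervalColoring (G : Multigraph) (t : ℕ) : Set where
  field
    α        : Fin (m G) → ℕ
    inRange  : ∀ e → 1 ≤ α e × α e ≤ t
    proper   : ∀ v e f → Inc G v e → Inc G v f → e ≢ f → α e ≢ α f
    allUsed  : ∀ c → 1 ≤ c → c ≤ t → ∃ λ e → α e ≡ c
    interval : ∀ v e f c → Inc G v e → Inc G v f → α e ≤ c → c ≤ α f →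
               ∃ λ g → Inc G v g × α g ≡ c

HasIntervalColoring : Multigraph → Set
HasIntervalColoring G = ∃ λ t → IntervalColoring G t

data Reach (G : Multigraph) (P : Fin (n G) → Set) : Fin (n G) → Fin (n G) → Set where
  here : ∀ {v} → P v → Reach G P v v
  step : ∀ {u v w} (e : Fin (m G)) → P u → Joins G e u v → Reach G P v w → Reach G P u w

ConnectedOn : (G : Multigraph) → (Fin (n G) → Set) → Set
ConnectedOn G P = ∀ u w → P u → P w → Reach G P u w

TwoConnected : Multigraph → Set
TwoConnected G = 2 ≤ n G × ConnectedOn G (λ _ → ⊤)
                 × (∀ x → ConnectedOn G (λ v → v ≢ x))

cyc : ∀ {k} → Fin (suc k) → Fin (suc k)
cyc {k} i = fromℕ< (m%n<n (suc (toℕ i)) (suc k))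

-- a cycle of length suc k (≥ 2): distinct vertices v₀ … v_k, distinct edges,
-- edge i joins v_i and v_{i+1 mod (k+1)}
record CycleOfLength (G : Multigraph) (k : ℕ) : Set where
  field
    len≥2 : 1 ≤ k
    vs    : Fin (suc k) → Fin (n G)
    es    : Fin (suc k) → Fin (m G)
    vsInj : Injective _≡_ _≡_ vs
    esInj : Injective _≡_ _≡_ es
    joins : ∀ i → Joins G (es i) (vs i) (vs (cyc i))

HasCycleOfLength : Multigraph → ℕ → Set
HasCycleOfLength G zero = ⊥
HasCycleOfLength G (suc k) = CycleOfLength G k

IsCircumference : Multigraph → ℕ → Set
IsCircumference G c = HasCycleOfLength G c × (∀ l → HasCycleOfLength G l → l ≤ c)

module Submission where

-- Two edges at a common vertex have colours differing by at most Δ − 1, as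
-- all colours in between occur at that vertex on distinct edges
-- (adjacentGap); so along a walk with ℓ edges colours drift by at most
-- (ℓ + 1)(Δ − 1) (walkDrift).  Let e, f have colours 1 and t.  In a
-- 2-connected graph any two edges lie on a common cycle (commonCycle), by an
-- ear argument: the vertices on cycles through e are closed under adjacency,
-- because a cycle can be rerouted through a detour that avoids one vertex.
-- Such a cycle has length L ≤ c and splits into two arcs from e to f; the
-- shorter arc has at most ⌊c/2⌋ vertices, which gives t − 1 ≤ ⌊c/2⌋(Δ − 1).

open import Defs
open import Data.Nat using (ℕ; zero; suc; _≤_; _<_; _+_; _*_; _∸_; _/_; _⊔_; _≤?_; _<?_; z≤n; s≤s)
open import Data.Nat.Properties
open import Data.Nat.DivMod using (m%n<n; m<n⇒m%n≡m; n%n≡0; m*n/n≡m; /-monoˡ-≤)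
open import Data.Nat.ListAction using (sum)
open import Data.Fin using (Fin; toℕ; fromℕ<) renaming (_≟_ to _≟ᶠ_)
open import Data.Fin.Properties
  using (toℕ-injective; toℕ-fromℕ<; toℕ<n; toℕ≤pred[n]; injective⇒≤)
open import Data.List
  using (List; []; _∷_; _++_; _∷ʳ_; length; filter; map; foldr; reverse; allFin; lookup)
open import Data.List.Properties using (++-assoc; length-++; unfold-reverse; length-reverse)
open import Data.List.Membership.Propositional using (_∈_; _∉_)
open import Data.List.Membership.Propositional.Properties
  using (∈-++⁺ˡ; ∈-++⁺ʳ; ∈-++⁻; ∈-filter⁺; ∈-allFin; ∈-map⁺)
import Data.List.Membership.DecPropositional as DecMembership
open import Data.List.Relation.Unary.Any using (here; there; index)
open import Data.List.Relation.Unary.Any.Properties using (lookup-index; reverse⁺; reverse⁻)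
open import Data.Bool using (Bool; true; false; T; if_then_else_; _∨_)
open import Data.Unit using (⊤; tt)
open import Data.Empty using (⊥-elim)
open import Data.Product using (Σ; ∃; _×_; _,_; proj₁; proj₂)
open import Data.Sum using (_⊎_; inj₁; inj₂; [_,_]; map₂)
open import Relation.Nullary using (does; yes; no)
open import Relation.Nullary.Decidable using (T?)
open import Function using (_∘_)
open import Relation.Binary.PropositionalEquality hiding ([_])

-- The standard library's Unique offers no
-- elimination rules for _++_, which the path surgery below needs, so we use
-- this form (head not in tail) together with its basic algebra.
data Distinct {A : Set} : List A → Set where
  []  : Distinct []
  _∷_ : ∀ {x xs} → x ∉ xs → Distinct xs → Distinct (x ∷ xs)

module _ {A : Set} where

  distinct-++ : {xs ys : List A} → Distinct xs → Distinct ys →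
                (∀ {x} → x ∈ xs → x ∉ ys) → Distinct (xs ++ ys)
  distinct-++ [] dys disjoint = dys
  distinct-++ {x ∷ xs} (x∉xs ∷ dxs) dys disjoint =
    (λ m → [ x∉xs , disjoint (here refl) ] (∈-++⁻ xs m)) ∷
    distinct-++ dxs dys (λ m → disjoint (there m))

  distinct-++ˡ : {xs ys : List A} → Distinct (xs ++ ys) → Distinct xs
  distinct-++ˡ {[]} _ = []
  distinct-++ˡ {x ∷ xs} (x∉ ∷ d) = (λ m → x∉ (∈-++⁺ˡ m)) ∷ distinct-++ˡ d

  distinct-++ʳ : (xs : List A) {ys : List A} → Distinct (xs ++ ys) → Distinct ys
  distinct-++ʳ [] d = d
  distinct-++ʳ (x ∷ xs) (_ ∷ d) = distinct-++ʳ xs d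

  distinct-disjoint : {xs ys : List A} {x : A} → Distinct (xs ++ ys) → x ∈ xs → x ∉ ys
  distinct-disjoint {x ∷ xs} (x∉ ∷ d) (here refl) m = x∉ (∈-++⁺ʳ xs m)
  distinct-disjoint {x ∷ xs} (x∉ ∷ d) (there p) m = distinct-disjoint d p m

  distinct-swap : (xs : List A) {ys : List A} → Distinct (xs ++ ys) → Distinct (ys ++ xs)
  distinct-swap xs d =
    distinct-++ (distinct-++ʳ xs d) (distinct-++ˡ d) (λ my mx → distinct-disjoint d mx my)

  distinct-reverse : {xs : List A} → Distinct xs → Distinct (reverse xs)
  distinct-reverse [] = []
  distinct-reverse {x ∷ xs} (x∉ ∷ d) = subst Distinct (sym (unfold-reverse x xs))
    (distinct-++ (distinct-reverse d) ((λ ()) ∷ []) λ { m (here refl) → x∉ (reverse⁻ m) })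

  distinct-replace : {xs rs ys qs : List A} {s t : A} →
    Distinct (xs ++ rs ++ ys) → Distinct (qs ∷ʳ t) → s ∈ rs → t ∈ ys →
    (∀ {x} → x ∈ qs → x ∈ xs ++ rs ++ ys → x ≡ s ⊎ x ≡ t) → Distinct (xs ++ qs ++ ys)
  distinct-replace {xs} {rs} {ys} {qs} {s} {t} d dq s∈rs t∈ys meets =
    distinct-++ (distinct-++ˡ d) distinct-qs++ys xs-apart
    where
      d-rs++ys : Distinct (rs ++ ys)
      d-rs++ys = distinct-++ʳ xs d
      t∉qs : t ∉ qs
      t∉qs m = distinct-disjoint dq m (here refl)
      distinct-qs++ys : Distinct (qs ++ ys)
      distinct-qs++ys = distinct-++ (distinct-++ˡ dq) (distinct-++ʳ rs d-rs++ys) qs-apart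
        where
          qs-apart : ∀ {x} → x ∈ qs → x ∉ ys
          qs-apart x∈qs x∈ys with meets x∈qs (∈-++⁺ʳ xs (∈-++⁺ʳ rs x∈ys))
          ... | inj₁ refl = distinct-disjoint d-rs++ys s∈rs x∈ys
          ... | inj₂ refl = t∉qs x∈qs
      xs-apart : ∀ {x} → x ∈ xs → x ∉ qs ++ ys
      xs-apart x∈xs m with ∈-++⁻ qs m
      ... | inj₂ x∈ys = distinct-disjoint d x∈xs (∈-++⁺ʳ rs x∈ys)
      ... | inj₁ x∈qs with meets x∈qs (∈-++⁺ˡ x∈xs)
      ...   | inj₁ refl = distinct-disjoint d x∈xs (∈-++⁺ˡ s∈rs)
      ...   | inj₂ refl = distinct-disjoint d x∈xs (∈-++⁺ʳ rs t∈ys)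

nth : ∀ {A : Set} → A → List A → ℕ → A
nth d [] _ = d
nth d (x ∷ xs) zero = x
nth d (x ∷ xs) (suc i) = nth d xs i

module _ {A : Set} {d : A} where

  nth-∈ : ∀ xs i → i < length xs → nth d xs i ∈ xs
  nth-∈ (x ∷ xs) zero _ = here refl
  nth-∈ (x ∷ xs) (suc i) (s≤s i<) = there (nth-∈ xs i i<)

  nth-injective : ∀ {xs} → Distinct xs → ∀ i j → i < length xs → j < length xs →
                  nth d xs i ≡ nth d xs j → i ≡ j
  nth-injective (_ ∷ _) zero zero _ _ _ = refl
  nth-injective {x ∷ xs} (x∉ ∷ _) zero (suc j) _ (s≤s j<) eq =
    ⊥-elim (x∉ (subst (_∈ xs) (sym eq) (nth-∈ xs j j<)))
  nth-injective {x ∷ xs} (x∉ ∷ _) (suc i) zero (s≤s i<) _ eq =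
    ⊥-elim (x∉ (subst (_∈ xs) eq (nth-∈ xs i i<)))
  nth-injective (_ ∷ dxs) (suc i) (suc j) (s≤s i<) (s≤s j<) eq =
    cong suc (nth-injective dxs i j i< j< eq)

  nth-++ˡ : ∀ xs {ys} i → i < length xs → nth d (xs ++ ys) i ≡ nth d xs i
  nth-++ˡ (x ∷ xs) zero _ = refl
  nth-++ˡ (x ∷ xs) (suc i) (s≤s i<) = nth-++ˡ xs i i<

  nth-++-length : ∀ xs {y ys} → nth d (xs ++ y ∷ ys) (length xs) ≡ y
  nth-++-length [] = refl
  nth-++-length (x ∷ xs) = nth-++-length xs

-- Residues modulo suc k as elements of Fin (suc k); note that the cyclic
-- successor of Defs is  cyc i = wrap (suc (toℕ i)).
wrap : ∀ {k} → ℕ → Fin (suc k)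
wrap {k} a = fromℕ< (m%n<n a (suc k))

toℕ-wrap : ∀ {k a} → a ≤ k → toℕ (wrap {k} a) ≡ a
toℕ-wrap {k} {a} a≤k = trans (toℕ-fromℕ< (m%n<n a (suc k))) (m<n⇒m%n≡m (s≤s a≤k))

toℕ-wrap-suc : ∀ k → toℕ (wrap {k} (suc k)) ≡ 0
toℕ-wrap-suc k = trans (toℕ-fromℕ< (m%n<n (suc k) (suc k))) (n%n≡0 (suc k))

double≤⇒≤half : ∀ {a c} → a + a ≤ c → a ≤ c / 2
double≤⇒≤half {a} {c} a+a≤c =
  subst (_≤ c / 2) (m*n/n≡m a 2) (/-monoˡ-≤ 2 (subst (_≤ c) a+a≡a*2 a+a≤c))
  where
    a+a≡a*2 : a + a ≡ a * 2
    a+a≡a*2 = trans (cong (a +_) (sym (+-identityʳ a))) (*-comm 2 a)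

smaller≤half : ∀ {a b c} → a + b ≤ c → a ≤ c / 2 ⊎ b ≤ c / 2
smaller≤half {a} {b} a+b≤c with a ≤? b
... | yes a≤b = inj₁ (double≤⇒≤half {a} (≤-trans (+-monoʳ-≤ a a≤b) a+b≤c))
... | no a≰b = inj₂ (double≤⇒≤half {b} (≤-trans (+-monoˡ-≤ b (<⇒≤ (≰⇒> a≰b))) a+b≤c))

bound-by-half : ∀ {a b c x y D} → a + b ≤ c →
                x ≤ y + a * D → x ≤ y + b * D → x ≤ y + (c / 2) * D
bound-by-half {a} {b} {c} {y = y} {D} a+b≤c xa xb with smaller≤half {a} {b} {c} a+b≤c
... | inj₁ a≤ = ≤-trans xa (+-monoʳ-≤ y (*-monoˡ-≤ D a≤))
... | inj₂ b≤ = ≤-trans xb (+-monoʳ-≤ y (*-monoˡ-≤ D b≤))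

length-filter≡count : ∀ {A : Set} (p : A → Bool) xs →
  length (filter (λ x → T? (p x)) xs) ≡ sum (map (λ x → if p x then 1 else 0) xs)
length-filter≡count p [] = refl
length-filter≡count p (x ∷ xs) with p x
... | true  = cong suc (length-filter≡count p xs)
... | false = length-filter≡count p xs

≤foldr-⊔ : ∀ {x xs} → x ∈ xs → x ≤ foldr _⊔_ 0 xs
≤foldr-⊔ {xs = y ∷ ys} (here refl) = m≤m⊔n y _
≤foldr-⊔ {xs = y ∷ ys} (there p)   = m≤n⇒m≤o⊔n y (≤foldr-⊔ p)

module Degrees (G : Multigraph) where

  incident? : Fin (n G) → Fin (m G) → Bool
  incident? v e = does (proj₁ (ends G e) ≟ᶠ v) ∨ does (proj₂ (ends G e) ≟ᶠ v)

  Inc⇒incident? : ∀ {v e} → Inc G v e → T (incident? v e)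
  Inc⇒incident? {v} {e} (inj₁ eq) with proj₁ (ends G e) ≟ᶠ v
  ... | yes _  = tt
  ... | no neq = ⊥-elim (neq eq)
  Inc⇒incident? {v} {e} (inj₂ eq) with proj₁ (ends G e) ≟ᶠ v | proj₂ (ends G e) ≟ᶠ v
  ... | yes _ | _      = tt
  ... | no _  | yes _  = tt
  ... | no _  | no neq = ⊥-elim (neq eq)

  -- k distinct edges incident to v witness deg v ≥ k: they inject into the
  -- list of incident edges whose length is deg v.
  distinctIncident≤deg : ∀ v k (h : Fin k → Fin (m G)) → (∀ i → Inc G v (h i)) →
                         (∀ {i j} → h i ≡ h j → i ≡ j) → k ≤ deg G v
  distinctIncident≤deg v k h inc h-inj =
    subst (k ≤_) (length-filter≡count (incident? v) (allFin (m G))) (injective⇒≤ position-inj)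
    where
      incidentEdges : List (Fin (m G))
      incidentEdges = filter (λ e → T? (incident? v e)) (allFin (m G))
      member : ∀ i → h i ∈ incidentEdges
      member i = ∈-filter⁺ (λ e → T? (incident? v e)) (∈-allFin (h i)) (Inc⇒incident? (inc i))
      position-inj : ∀ {i j} → index (member i) ≡ index (member j) → i ≡ j
      position-inj {i} {j} eq = h-inj (trans (lookup-index (member i))
        (trans (cong (lookup incidentEdges) eq) (sym (lookup-index (member j)))))

  deg≤maxDeg : ∀ v → deg G v ≤ maxDeg G
  deg≤maxDeg v = ≤foldr-⊔ (∈-map⁺ (deg G) (∈-allFin v))

  module Colouring {t : ℕ} (col : IntervalColoring G t) where
    open IntervalColoring col

    -- At a vertex v, every colour between α e and α f is carried by an
    -- edge at v, and these edges are distinct; so the range has ≤ Δ colours.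
    colourRange≤maxDeg : ∀ {v e f} → Inc G v e → Inc G v f → α e ≤ α f →
                         suc (α f ∸ α e) ≤ maxDeg G
    colourRange≤maxDeg {v} {e} {f} ve vf αe≤αf =
      ≤-trans (distinctIncident≤deg v _ edgeOf edgeOf-inc edgeOf-inj) (deg≤maxDeg v)
      where
        inColourRange : ∀ (i : Fin (suc (α f ∸ α e))) → α e + toℕ i ≤ α f
        inColourRange i =
          subst (α e + toℕ i ≤_) (m+[n∸m]≡n αe≤αf) (+-monoʳ-≤ (α e) (toℕ≤pred[n] i))
        carrier : ∀ i → ∃ λ g → Inc G v g × α g ≡ α e + toℕ i
        carrier i = interval v e f (α e + toℕ i) ve vf (m≤m+n _ _) (inColourRange i)
        edgeOf : Fin (suc (α f ∸ α e)) → Fin (m G)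
        edgeOf i = proj₁ (carrier i)
        edgeOf-inc : ∀ i → Inc G v (edgeOf i)
        edgeOf-inc i = proj₁ (proj₂ (carrier i))
        edgeOf-inj : ∀ {i j} → edgeOf i ≡ edgeOf j → i ≡ j
        edgeOf-inj {i} {j} eq = toℕ-injective (+-cancelˡ-≡ (α e) _ _ (begin
          α e + toℕ i     ≡⟨ proj₂ (proj₂ (carrier i)) ⟨
          α (edgeOf i)    ≡⟨ cong α eq ⟩
          α (edgeOf j)    ≡⟨ proj₂ (proj₂ (carrier j)) ⟩
          α e + toℕ j     ∎))
          where open ≡-Reasoning

    adjacentGap : ∀ {v e f} → Inc G v e → Inc G v f → α f ≤ α e + (maxDeg G ∸ 1)
    adjacentGap {v} {e} {f} ve vf with α f ≤? α e
    ... | yes αf≤αe = ≤-trans αf≤αe (m≤m+n _ _)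
    ... | no αf≰αe = subst (_≤ α e + (maxDeg G ∸ 1)) (m+[n∸m]≡n αe≤αf)
                       (+-monoʳ-≤ (α e) (∸-monoˡ-≤ 1 (colourRange≤maxDeg ve vf αe≤αf)))
      where
        αe≤αf : α e ≤ α f
        αe≤αf = <⇒≤ (≰⇒> αf≰αe)

module Walks (G : Multigraph) where

  V : Set
  V = Fin (n G)

  E : Set
  E = Fin (m G)

  data Walk : V → V → Set where
    nil  : ∀ v → Walk v v
    cons : ∀ {u v w} (h : E) → Joins G h u v → Walk v w → Walk u w

  verts : ∀ {u w} → Walk u w → List V
  verts (nil v) = v ∷ []
  verts (cons {u} h j p) = u ∷ verts p

  initVerts : ∀ {u w} → Walk u w → List V
  initVerts (nil v) = []
  initVerts (cons {u} h j p) = u ∷ initVerts p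

  edges : ∀ {u w} → Walk u w → List E
  edges (nil v) = []
  edges (cons h j p) = h ∷ edges p

  append : ∀ {u v w} → Walk u v → Walk v w → Walk u w
  append (nil _) q = q
  append (cons h j p) q = cons h j (append p q)

  append-assoc : ∀ {a b c d} (p : Walk a b) (q : Walk b c) (r : Walk c d) →
                 append (append p q) r ≡ append p (append q r)
  append-assoc (nil _) q r = refl
  append-assoc (cons h j p) q r = cong (cons h j) (append-assoc p q r)

  verts-append : ∀ {u v w} (p : Walk u v) (q : Walk v w) →
                 verts (append p q) ≡ initVerts p ++ verts q
  verts-append (nil _) q = refl
  verts-append (cons {u} h j p) q = cong (u ∷_) (verts-append p q)

  edges-append : ∀ {u v w} (p : Walk u v) (q : Walk v w) →
                 edges (append p q) ≡ edges p ++ edges q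
  edges-append (nil _) q = refl
  edges-append (cons h j p) q = cong (h ∷_) (edges-append p q)

  verts≡initVerts∷ʳend : ∀ {u w} (p : Walk u w) → verts p ≡ initVerts p ∷ʳ w
  verts≡initVerts∷ʳend (nil _) = refl
  verts≡initVerts∷ʳend (cons {u} h j p) = cong (u ∷_) (verts≡initVerts∷ʳend p)

  verts-append-cons : ∀ {a b c d} (q : Walk a b) (h : E) (j : Joins G h b c) (r : Walk c d) →
                      verts (append q (cons h j r)) ≡ verts q ++ verts r
  verts-append-cons {b = b} q h j r = begin
    verts (append q (cons h j r))  ≡⟨ verts-append q _ ⟩
    initVerts q ++ b ∷ verts r     ≡⟨ ++-assoc (initVerts q) (b ∷ []) (verts r) ⟨
    (initVerts q ∷ʳ b) ++ verts r  ≡⟨ cong (_++ verts r) (verts≡initVerts∷ʳend q) ⟨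
    verts q ++ verts r             ∎
    where open ≡-Reasoning

  start∈ : ∀ {u w} (p : Walk u w) → u ∈ verts p
  start∈ (nil _) = here refl
  start∈ (cons h j p) = here refl

  end∈ : ∀ {u w} (p : Walk u w) → w ∈ verts p
  end∈ (nil _) = here refl
  end∈ (cons h j p) = there (end∈ p)

  initVerts⊆verts : ∀ {u w x} (p : Walk u w) → x ∈ initVerts p → x ∈ verts p
  initVerts⊆verts (cons h j p) (here refl) = here refl
  initVerts⊆verts (cons h j p) (there m) = there (initVerts⊆verts p m)

  splitAt : ∀ {u w x} (p : Walk u w) → x ∈ verts p →
            Σ (Walk u x) λ p₁ → Σ (Walk x w) λ p₂ → p ≡ append p₁ p₂
  splitAt (nil _) (here refl) = nil _ , nil _ , refl
  splitAt (cons h j p) (here refl) = nil _ , cons h j p , refl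
  splitAt (cons h j p) (there m) with splitAt p m
  ... | p₁ , p₂ , refl = cons h j p₁ , p₂ , refl

  splitAtEdge : ∀ {u w g} (p : Walk u w) → g ∈ edges p →
    Σ V λ s → Σ V λ t → Σ (Walk u s) λ p₁ → Σ (Joins G g s t) λ j →
      Σ (Walk t w) λ p₂ → p ≡ append p₁ (cons g j p₂)
  splitAtEdge (cons h j p) (here refl) = _ , _ , nil _ , j , p , refl
  splitAtEdge (cons h j p) (there m) with splitAtEdge p m
  ... | s , t , p₁ , j' , p₂ , refl = s , t , cons h j p₁ , j' , p₂ , refl

  joins-sym : ∀ {h u v} → Joins G h u v → Joins G h v u
  joins-sym (inj₁ eq) = inj₂ eq
  joins-sym (inj₂ eq) = inj₁ eq

  joins-ends : ∀ {h u v} → Joins G h u v →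
    (proj₁ (ends G h) ≡ u × proj₂ (ends G h) ≡ v) ⊎
    (proj₁ (ends G h) ≡ v × proj₂ (ends G h) ≡ u)
  joins-ends (inj₁ eq) = inj₁ (cong proj₁ eq , cong proj₂ eq)
  joins-ends (inj₂ eq) = inj₂ (cong proj₁ eq , cong proj₂ eq)

  joins-distinct : ∀ {h u v} → Joins G h u v → u ≢ v
  joins-distinct {h} j refl with joins-ends j
  ... | inj₁ (e₁ , e₂) = loopless G h (trans e₁ (sym e₂))
  ... | inj₂ (e₁ , e₂) = loopless G h (trans e₁ (sym e₂))

  joins-inc : ∀ {h u v} → Joins G h u v → Inc G u h × Inc G v h
  joins-inc j with joins-ends j
  ... | inj₁ (e₁ , e₂) = inj₁ e₁ , inj₂ e₂
  ... | inj₂ (e₁ , e₂) = inj₂ e₂ , inj₁ e₁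

  rev : ∀ {u w} → Walk u w → Walk w u
  rev (nil v) = nil v
  rev (cons h j p) = append (rev p) (cons h (joins-sym j) (nil _))

  verts-rev : ∀ {u w} (p : Walk u w) → verts (rev p) ≡ reverse (verts p)
  verts-rev (nil _) = refl
  verts-rev (cons {u} {v} h j p) = begin
    verts (append (rev p) (cons h (joins-sym j) (nil u)))
      ≡⟨ verts-append (rev p) _ ⟩
    initVerts (rev p) ++ (v ∷ u ∷ [])
      ≡⟨ ++-assoc (initVerts (rev p)) (v ∷ []) (u ∷ []) ⟨
    (initVerts (rev p) ∷ʳ v) ∷ʳ u
      ≡⟨ cong (_∷ʳ u) (verts≡initVerts∷ʳend (rev p)) ⟨
    verts (rev p) ∷ʳ u
      ≡⟨ cong (_∷ʳ u) (verts-rev p) ⟩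
    reverse (verts p) ∷ʳ u
      ≡⟨ unfold-reverse u (verts p) ⟨
    reverse (u ∷ verts p)
      ∎
    where open ≡-Reasoning

  edges-rev : ∀ {u w} (p : Walk u w) → edges (rev p) ≡ reverse (edges p)
  edges-rev (nil _) = refl
  edges-rev (cons h j p) = begin
    edges (append (rev p) (cons h (joins-sym j) (nil _))) ≡⟨ edges-append (rev p) _ ⟩
    edges (rev p) ∷ʳ h                                   ≡⟨ cong (_∷ʳ h) (edges-rev p) ⟩
    reverse (edges p) ∷ʳ h                               ≡⟨ unfold-reverse h (edges p) ⟨
    reverse (h ∷ edges p)                                ∎
    where open ≡-Reasoning

  edgeEnds∈verts : ∀ {u w g} (p : Walk u w) → g ∈ edges p →
                   proj₁ (ends G g) ∈ verts p × proj₂ (ends G g) ∈ verts p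
  edgeEnds∈verts (cons h j p) (here refl) with joins-ends j
  ... | inj₁ (e₁ , e₂) = here e₁ , there (subst (_∈ verts p) (sym e₂) (start∈ p))
  ... | inj₂ (e₁ , e₂) = there (subst (_∈ verts p) (sym e₁) (start∈ p)) , here e₂
  edgeEnds∈verts (cons h j p) (there m) with edgeEnds∈verts p m
  ... | m₁ , m₂ = there m₁ , there m₂

  length-verts : ∀ {u w} (p : Walk u w) → length (verts p) ≡ suc (length (edges p))
  length-verts (nil _) = refl
  length-verts (cons h j p) = cong suc (length-verts p)

  nth-verts-zero : ∀ {d u w} (p : Walk u w) → nth d (verts p) 0 ≡ u
  nth-verts-zero (nil _) = refl
  nth-verts-zero (cons h j p) = refl

  nth-verts-last : ∀ {d u w} (p : Walk u w) → nth d (verts p) (length (edges p)) ≡ w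
  nth-verts-last (nil _) = refl
  nth-verts-last (cons h j p) = nth-verts-last p

  nth-edge-joins : ∀ {d d' u w} (p : Walk u w) i → i < length (edges p) →
                   Joins G (nth d' (edges p) i) (nth d (verts p) i) (nth d (verts p) (suc i))
  nth-edge-joins (cons h j p) zero _ = subst (Joins G h _) (sym (nth-verts-zero p)) j
  nth-edge-joins (cons h j p) (suc i) (s≤s i<) = nth-edge-joins p i i<

  nonempty : ∀ {u w} (p : Walk u w) → u ≢ w → 1 ≤ length (edges p)
  nonempty (nil _) u≢w = ⊥-elim (u≢w refl)
  nonempty (cons _ _ _) _ = s≤s z≤n

  seqWalk : (f : ℕ → V) (g : ℕ → E) (d : ℕ) →
            (∀ i → i < d → Joins G (g i) (f i) (f (suc i))) → Walk (f 0) (f d)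
  seqWalk f g zero js = nil (f 0)
  seqWalk f g (suc d) js =
    cons (g 0) (js 0 (s≤s z≤n)) (seqWalk (f ∘ suc) (g ∘ suc) d (λ i i<d → js (suc i) (s≤s i<d)))

  seqWalk-verts : ∀ f g d js {x} → x ∈ verts (seqWalk f g d js) → ∃ λ i → i ≤ d × x ≡ f i
  seqWalk-verts f g zero js (here refl) = 0 , z≤n , refl
  seqWalk-verts f g (suc d) js (here refl) = 0 , z≤n , refl
  seqWalk-verts f g (suc d) js (there m) with seqWalk-verts _ _ d _ m
  ... | i , i≤d , eq = suc i , s≤s i≤d , eq

  seqWalk-edges : ∀ f g d js {x} → x ∈ edges (seqWalk f g d js) → ∃ λ i → i < d × x ≡ g i
  seqWalk-edges f g (suc d) js (here refl) = 0 , s≤s z≤n , refl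
  seqWalk-edges f g (suc d) js (there m) with seqWalk-edges _ _ d _ m
  ... | i , i<d , eq = suc i , s≤s i<d , eq

  seqWalk-distinct : ∀ f g d js → (∀ {i j} → i ≤ d → j ≤ d → f i ≡ f j → i ≡ j) →
                     Distinct (verts (seqWalk f g d js))
  seqWalk-distinct f g zero js f-inj = (λ ()) ∷ []
  seqWalk-distinct f g (suc d) js f-inj =
    f0∉rest ∷ seqWalk-distinct _ _ d _ (λ i≤ j≤ eq → suc-injective (f-inj (s≤s i≤) (s≤s j≤) eq))
    where
      f0∉rest : f 0 ∉ verts (seqWalk (f ∘ suc) (g ∘ suc) d (λ i i<d → js (suc i) (s≤s i<d)))
      f0∉rest m with seqWalk-verts _ _ d _ m
      ... | i , i≤d , eq = 0≢1+n (f-inj z≤n (s≤s i≤d) eq)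

  distinct-edges : ∀ {u w} (p : Walk u w) → Distinct (verts p) → Distinct (edges p)
  distinct-edges (nil _) _ = []
  distinct-edges (cons {u} h j p) (u∉ ∷ dp) = h∉ ∷ distinct-edges p dp
    where
      h∉ : h ∉ edges p
      h∉ m with edgeEnds∈verts p m | joins-ends j
      ... | m₁ , m₂ | inj₁ (e₁ , e₂) = u∉ (subst (_∈ verts p) e₁ m₁)
      ... | m₁ , m₂ | inj₂ (e₁ , e₂) = u∉ (subst (_∈ verts p) e₂ m₂)

module Rerouting (G : Multigraph) where
  open Walks G

  MeetsOnlyAt : ∀ {b a u w} → Walk b a → Walk u w → V → V → Set
  MeetsOnlyAt P Q s t = ∀ {x} → x ∈ verts Q → x ∈ verts P → x ≡ s ⊎ x ≡ t

  record Rerouted {b a u w} (P : Walk b a) (Q : Walk u w) : Set where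
    field
      path          : Walk b a
      distinct      : Distinct (verts path)
      edges-from    : ∀ {g} → g ∈ edges path → g ∈ edges P ⊎ g ∈ edges Q
      detour-inside : ∀ {g} → g ∈ edges Q → g ∈ edges path

  start∈initVerts : ∀ {s t} (R : Walk s t) → s ≢ t → s ∈ initVerts R
  start∈initVerts (nil _) s≢t = ⊥-elim (s≢t refl)
  start∈initVerts (cons h j R) s≢t = here refl

  replaceSegment : ∀ {b s t a} (P₁ : Walk b s) (R : Walk s t) (P₃ : Walk t a) (Q : Walk s t) →
    Distinct (verts (append P₁ (append R P₃))) → Distinct (verts Q) → s ≢ t →
    MeetsOnlyAt (append P₁ (append R P₃)) Q s t → Rerouted (append P₁ (append R P₃)) Q
  replaceSegment {t = t} P₁ R P₃ Q dP dQ s≢t meets = record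
    { path = append P₁ (append Q P₃)
    ; distinct = subst Distinct (sym (vertsThrough Q)) (distinct-replace {xs = initVerts P₁}
        (subst Distinct (vertsThrough R) dP) (subst Distinct (verts≡initVerts∷ʳend Q) dQ)
        (start∈initVerts R s≢t) (start∈ P₃)
        (λ x∈Q x∈P → meets (initVerts⊆verts Q x∈Q) (subst (_ ∈_) (sym (vertsThrough R)) x∈P)))
    ; edges-from = edges-from
    ; detour-inside = λ g∈Q →
        subst (_ ∈_) (sym (edgesThrough Q)) (∈-++⁺ʳ (edges P₁) (∈-++⁺ˡ g∈Q))
    }
    where
      vertsThrough : (S : Walk _ t) →
                     verts (append P₁ (append S P₃)) ≡ initVerts P₁ ++ initVerts S ++ verts P₃
      vertsThrough S = trans (verts-append P₁ _) (cong (initVerts P₁ ++_) (verts-append S P₃))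
      edgesThrough : (S : Walk _ t) →
                     edges (append P₁ (append S P₃)) ≡ edges P₁ ++ edges S ++ edges P₃
      edgesThrough S = trans (edges-append P₁ _) (cong (edges P₁ ++_) (edges-append S P₃))
      edges-from : ∀ {g} → g ∈ edges (append P₁ (append Q P₃)) →
                   g ∈ edges (append P₁ (append R P₃)) ⊎ g ∈ edges Q
      edges-from m with ∈-++⁻ (edges P₁) (subst (_ ∈_) (edgesThrough Q) m)
      ... | inj₁ m₁ = inj₁ (subst (_ ∈_) (sym (edgesThrough R)) (∈-++⁺ˡ m₁))
      ... | inj₂ m₂ with ∈-++⁻ (edges Q) m₂
      ...   | inj₁ m-Q = inj₂ m-Q
      ...   | inj₂ m₃ =
        inj₁ (subst (_ ∈_) (sym (edgesThrough R)) (∈-++⁺ʳ (edges P₁) (∈-++⁺ʳ (edges R) m₃)))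

  rerouted-rev : ∀ {b a u w} {P : Walk b a} {Q : Walk u w} → Rerouted P (rev Q) → Rerouted P Q
  rerouted-rev {Q = Q} r = record
    { path = path
    ; distinct = distinct
    ; edges-from = λ m → map₂ (λ m-Q → reverse⁻ (subst (_ ∈_) (edges-rev Q) m-Q)) (edges-from m)
    ; detour-inside = λ m-Q → detour-inside (subst (_ ∈_) (sym (edges-rev Q)) (reverse⁺ m-Q))
    }
    where open Rerouted r

  -- A path P can be rerouted through any path Q joining two distinct
  -- vertices w, y of P and meeting P only there: split P at w and y, and
  -- replace the segment between them by Q or by its reversal.
  reroute : ∀ {b a w y} (P : Walk b a) (Q : Walk w y) → Distinct (verts P) →
    Distinct (verts Q) → w ≢ y → w ∈ verts P → y ∈ verts P → MeetsOnlyAt P Q w y → Rerouted P Q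
  reroute P Q dP dQ w≢y w∈P y∈P meets with splitAt P w∈P
  ... | P₁ , P₂ , refl with ∈-++⁻ (initVerts P₁) (subst (_ ∈_) (verts-append P₁ P₂) y∈P)
  ...   | inj₂ y∈P₂ with splitAt P₂ y∈P₂
  ...     | R , P₃ , refl = replaceSegment P₁ R P₃ Q dP dQ w≢y meets
  reroute P Q dP dQ w≢y w∈P y∈P meets | P₁ , P₂ , refl | inj₁ y∈P₁
    with splitAt P₁ (initVerts⊆verts P₁ y∈P₁)
  ...     | P₀ , R , refl = subst (λ P' → Rerouted P' Q) (sym reassoc) (rerouted-rev rerouted)
    where
      reassoc : append (append P₀ R) P₂ ≡ append P₀ (append R P₂)
      reassoc = append-assoc P₀ R P₂
      verts-rev⁻ : ∀ {x} → x ∈ verts (rev Q) → x ∈ verts Q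
      verts-rev⁻ m = reverse⁻ (subst (_ ∈_) (verts-rev Q) m)
      dQ-rev : Distinct (verts (rev Q))
      dQ-rev = subst Distinct (sym (verts-rev Q)) (distinct-reverse dQ)
      meets-rev : MeetsOnlyAt (append P₀ (append R P₂)) (rev Q) _ _
      meets-rev x∈Q x∈P with meets (verts-rev⁻ x∈Q) (subst (λ P' → _ ∈ verts P') (sym reassoc) x∈P)
      ... | inj₁ x≡w = inj₂ x≡w
      ... | inj₂ x≡y = inj₁ x≡y
      rerouted : Rerouted (append P₀ (append R P₂)) (rev Q)
      rerouted = replaceSegment P₀ R P₂ (rev Q) (subst (λ P' → Distinct (verts P')) reassoc dP)
        dQ-rev (λ y≡w → w≢y (sym y≡w)) meets-rev

module FirstEntry (G : Multigraph) where
  open Walks G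
  open DecMembership (_≟ᶠ_ {n G}) using (_∈?_)

  record EntryPath (R : V → Set) (S : List V) (u : V) : Set where
    field
      {target}       : V
      target∈S       : target ∈ S
      walk           : Walk u target
      distinct       : Distinct (verts walk)
      inside         : ∀ {x} → x ∈ verts walk → R x
      meetsOnlyAtEnd : ∀ {x} → x ∈ verts walk → x ∈ S → x ≡ target

  trivialEntry : ∀ {R u} {S : List V} → R u → u ∈ S → EntryPath R S u
  trivialEntry Ru u∈S = record
    { target∈S = u∈S ; walk = nil _ ; distinct = (λ ()) ∷ []
    ; inside = λ { (here refl) → Ru } ; meetsOnlyAtEnd = λ { (here refl) _ → refl } }

  -- If u reaches some vertex of S inside R, then there is an entry path:
  -- walk along the reachability witness, stop at the first vertex of S, and
  -- cut out the closed part whenever a vertex repeats.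
  firstEntry : ∀ {R u a} (S : List V) → Reach G R u a → a ∈ S → EntryPath R S u
  firstEntry S (here Ra) a∈S = trivialEntry Ra a∈S
  firstEntry {u = u} S (step h Ru j rest) a∈S with u ∈? S
  ... | yes u∈S = trivialEntry Ru u∈S
  ... | no u∉S with firstEntry S rest a∈S
  ...   | entry with u ∈? verts (EntryPath.walk entry)
  ...     | no u∉walk = record
    { target∈S = target∈S ; walk = cons h j walk ; distinct = u∉walk ∷ distinct
    ; inside = λ { (here refl) → Ru ; (there m) → inside m }
    ; meetsOnlyAtEnd = λ { (here refl) u∈S → ⊥-elim (u∉S u∈S) ; (there m) → meetsOnlyAtEnd m } }
    where open EntryPath entry
  ...     | yes u∈walk with splitAt (EntryPath.walk entry) u∈walk
  ...       | q₁ , q₂ , walk≡q₁q₂ = record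
    { target∈S = target∈S
    ; walk = q₂
    ; distinct = distinct-++ʳ (initVerts q₁) (subst Distinct verts-walk distinct)
    ; inside = λ m → inside (in-walk m)
    ; meetsOnlyAtEnd = λ m → meetsOnlyAtEnd (in-walk m) }
    where
      open EntryPath entry
      verts-walk : verts walk ≡ initVerts q₁ ++ verts q₂
      verts-walk = trans (cong verts walk≡q₁q₂) (verts-append q₁ q₂)
      in-walk : ∀ {x} → x ∈ verts q₂ → x ∈ verts walk
      in-walk m = subst (_ ∈_) (sym verts-walk) (∈-++⁺ʳ (initVerts q₁) m)

  -- An edge with both ends in S is not on an entry path into S: both ends
  -- would be the target, making the edge a loop.
  chord∉entry : ∀ {R S u h} (entry : EntryPath R S u) →
                proj₁ (ends G h) ∈ S → proj₂ (ends G h) ∈ S → h ∉ edges (EntryPath.walk entry)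
  chord∉entry {h = h} entry h₁∈S h₂∈S h∈walk = loopless G h
    (trans (meetsOnlyAtEnd (proj₁ h-ends) h₁∈S) (sym (meetsOnlyAtEnd (proj₂ h-ends) h₂∈S)))
    where
      open EntryPath entry
      h-ends : proj₁ (ends G h) ∈ verts walk × proj₂ (ends G h) ∈ verts walk
      h-ends = edgeEnds∈verts walk h∈walk

module CyclesThroughEdges (G : Multigraph) where
  open Walks G

  record CycleThrough (e : E) : Set where
    constructor cycleThrough
    field
      {x y}    : V
      path     : Walk x y
      closing  : Joins G e y x
      distinct : Distinct (verts path)
      e∉path   : e ∉ edges path
  open CycleThrough using (path; closing)

  cycleLength : ∀ {e} → CycleThrough e → ℕ
  cycleLength C = suc (length (edges (path C)))

  OnCycle : ∀ {e} → CycleThrough e → E → Set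
  OnCycle {e} C g = g ≡ e ⊎ g ∈ edges (path C)

  EdgeOnCycleThrough : E → E → Set
  EdgeOnCycleThrough e g = Σ (CycleThrough e) λ C → OnCycle C g

  cycleEdgeEnds∈verts : ∀ {e g} (C : CycleThrough e) → OnCycle C g →
                        proj₁ (ends G g) ∈ verts (path C) × proj₂ (ends G g) ∈ verts (path C)
  cycleEdgeEnds∈verts C (inj₂ g∈P) = edgeEnds∈verts (path C) g∈P
  cycleEdgeEnds∈verts C (inj₁ refl) with joins-ends (closing C)
  ... | inj₁ (e₁ , e₂) = subst (_∈ verts (path C)) (sym e₁) (end∈ (path C)) ,
                         subst (_∈ verts (path C)) (sym e₂) (start∈ (path C))
  ... | inj₂ (e₁ , e₂) = subst (_∈ verts (path C)) (sym e₁) (start∈ (path C)) ,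
                         subst (_∈ verts (path C)) (sym e₂) (end∈ (path C))

  -- a cycle has a vertex other than any given w (the closing edge is no loop)
  anotherVertex : ∀ {e} (C : CycleThrough e) (w : V) → Σ V λ a → a ∈ verts (path C) × a ≢ w
  anotherVertex {e} C w with w ≟ᶠ proj₁ (ends G e) | cycleEdgeEnds∈verts C (inj₁ refl)
  ... | yes refl | _ , e₂∈P = proj₂ (ends G e) , e₂∈P , (λ e₂≡e₁ → loopless G e (sym e₂≡e₁))
  ... | no w≢e₁  | e₁∈P , _ = proj₁ (ends G e) , e₁∈P , (λ e₁≡w → w≢e₁ (sym e₁≡w))

  -- Rotation: a cycle through e₀ that contains e can be read as a cycle
  -- through e, by splitting the path at e and swapping the two parts.
  rotate : ∀ {e₀ e} (C : CycleThrough e₀) → OnCycle C e → CycleThrough e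
  rotate C (inj₁ refl) = C
  rotate {e₀} {e} (cycleThrough P j₀ dP e₀∉P) (inj₂ e∈P) with splitAtEdge P e∈P
  ... | s , t , p₁ , j , p₂ , refl =
    cycleThrough (append p₂ (cons e₀ j₀ p₁)) j distinct-rotated e∉rotated
    where
      distinct-rotated : Distinct (verts (append p₂ (cons e₀ j₀ p₁)))
      distinct-rotated = subst Distinct (sym (verts-append-cons p₂ e₀ j₀ p₁))
        (distinct-swap (verts p₁) (subst Distinct (verts-append-cons p₁ e j p₂) dP))
      distinct-edgesP : Distinct (edges p₁ ++ e ∷ edges p₂)
      distinct-edgesP = subst Distinct (edges-append p₁ _) (distinct-edges _ dP)
      e∉rotated : e ∉ edges (append p₂ (cons e₀ j₀ p₁))
      e∉rotated m with ∈-++⁻ (edges p₂) (subst (_ ∈_) (edges-append p₂ _) m)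
      ... | inj₁ e∈p₂ with distinct-++ʳ (edges p₁) distinct-edgesP
      ...   | e∉p₂ ∷ _ = e∉p₂ e∈p₂
      e∉rotated m | inj₂ (here refl) = e₀∉P e∈P
      e∉rotated m | inj₂ (there e∈p₁) = distinct-disjoint distinct-edgesP e∈p₁ (here refl)

  -- A cycle v₀ … v_k (in the sense of Defs) is a cycle through its last edge:
  -- the path v₀ … v_k closed by the edge from v_k back to v₀.
  fromCycleOfLength : ∀ {k} → CycleOfLength G k → Σ E CycleThrough
  fromCycleOfLength {k} Cy = edge k , cycleThrough
    (seqWalk vertex edge k (λ i i<k → cycleStep i (<⇒≤ i<k)))
    closingStep
    (seqWalk-distinct vertex edge k _ (injectiveUpTo vsInj))
    edge-k∉path
    where
      open CycleOfLength Cy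
      vertex : ℕ → V
      vertex a = vs (wrap a)
      edge : ℕ → E
      edge a = es (wrap a)
      cycleStep : ∀ a → a ≤ k → Joins G (edge a) (vertex a) (vertex (suc a))
      cycleStep a a≤k =
        subst (λ b → Joins G (edge a) (vertex a) (vertex (suc b))) (toℕ-wrap a≤k) (joins (wrap a))
      closingStep : Joins G (edge k) (vertex k) (vertex 0)
      closingStep = subst (λ a → Joins G (edge k) (vertex k) (vs a))
        (toℕ-injective (trans (toℕ-wrap-suc k) (sym (toℕ-wrap {k} z≤n)))) (cycleStep k ≤-refl)
      injectiveUpTo : ∀ {A : Set} {h : Fin (suc k) → A} → (∀ {i j} → h i ≡ h j → i ≡ j) →
                      ∀ {a b} → a ≤ k → b ≤ k → h (wrap a) ≡ h (wrap b) → a ≡ b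
      injectiveUpTo h-inj a≤k b≤k eq =
        trans (sym (toℕ-wrap a≤k)) (trans (cong toℕ (h-inj eq)) (toℕ-wrap b≤k))
      edge-k∉path : edge k ∉ edges (seqWalk vertex edge k _)
      edge-k∉path m with seqWalk-edges vertex edge k _ m
      ... | i , i<k , eq = <-irrefl (sym (injectiveUpTo esInj ≤-refl (<⇒≤ i<k) eq)) i<k

  -- Conversely, a cycle through e is a cycle of the same length in the sense
  -- of Defs (where CycleOfLength G ℓ describes cycles of length ℓ + 1).
  toCycleOfLength : ∀ {e} (C : CycleThrough e) → CycleOfLength G (length (edges (path C)))
  toCycleOfLength {e} (cycleThrough {x} {y} P closing dP e∉P) = record
    { len≥2 = nonempty P (λ x≡y → joins-distinct closing (sym x≡y))
    ; vs = vs ; es = es ; vsInj = vs-inj ; esInj = es-inj ; joins = joins }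
    where
      k : ℕ
      k = length (edges P)
      vs : Fin (suc k) → V
      vs i = nth x (verts P) (toℕ i)
      es : Fin (suc k) → E
      es i = nth e (edges P ∷ʳ e) (toℕ i)
      vs-inj : ∀ {i j} → vs i ≡ vs j → i ≡ j
      vs-inj {i} {j} = toℕ-injective ∘ nth-injective dP (toℕ i) (toℕ j) (bound i) (bound j)
        where
          bound : ∀ (i : Fin (suc k)) → toℕ i < length (verts P)
          bound i = subst (toℕ i <_) (sym (length-verts P)) (toℕ<n i)
      es-inj : ∀ {i j} → es i ≡ es j → i ≡ j
      es-inj {i} {j} = toℕ-injective ∘ nth-injective
        (distinct-++ (distinct-edges P dP) ((λ ()) ∷ []) λ { m (here refl) → e∉P m })
        (toℕ i) (toℕ j) (bound i) (bound j)
        where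
          bound : ∀ (i : Fin (suc k)) → toℕ i < length (edges P ∷ʳ e)
          bound i = subst (toℕ i <_) (sym (trans (length-++ (edges P)) (+-comm k 1))) (toℕ<n i)
      -- an inner position i < k follows the path; position k is the closing edge
      joins : ∀ i → Joins G (es i) (vs i) (vs (cyc i))
      joins i with toℕ i <? k
      ... | yes i<k = subst₂ (λ g v → Joins G g (vs i) v)
            (sym (nth-++ˡ (edges P) (toℕ i) i<k)) (cong (nth x (verts P)) (sym (toℕ-wrap i<k)))
            (nth-edge-joins P (toℕ i) i<k)
      ... | no i≮k = subst₂ (λ g v → Joins G g v (vs (cyc i))) (sym es-last) (sym vs-last)
            (subst (Joins G e y) (sym vs-next) closing)
        where
          i≡k : toℕ i ≡ k
          i≡k = ≤-antisym (toℕ≤pred[n] i) (≮⇒≥ i≮k)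
          es-last : es i ≡ e
          es-last = trans (cong (nth e (edges P ∷ʳ e)) i≡k) (nth-++-length (edges P))
          vs-last : vs i ≡ y
          vs-last = trans (cong (nth x (verts P)) i≡k) (nth-verts-last P)
          vs-next : vs (cyc i) ≡ x
          vs-next = begin
            nth x (verts P) (toℕ (wrap {k} (suc (toℕ i))))
              ≡⟨ cong (λ a → nth x (verts P) (toℕ (wrap {k} (suc a)))) i≡k ⟩
            nth x (verts P) (toℕ (wrap {k} (suc k)))
              ≡⟨ cong (nth x (verts P)) (toℕ-wrap-suc k) ⟩
            nth x (verts P) 0
              ≡⟨ nth-verts-zero P ⟩
            x ∎
            where open ≡-Reasoning

module CommonCycles (G : Multigraph) (2conn : TwoConnected G) where
  open Walks G
  open Rerouting G
  open FirstEntry G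
  open CyclesThroughEdges G
  open CycleThrough using (path; closing; distinct; e∉path)

  connected : ConnectedOn G (λ _ → ⊤)
  connected = proj₁ (proj₂ 2conn)

  connectedWithout : ∀ w → ConnectedOn G (λ v → v ≢ w)
  connectedWithout = proj₂ (proj₂ 2conn)

  -- Since G − w is connected, the far end z of g reaches
  -- the cycle avoiding w; the first such entry path, preceded by g, is a
  -- detour along which the cycle is rerouted.  The closing edge e survives
  -- because both its ends lie on the cycle, so it is not on the detour.
  ear : ∀ {e w z g} (C : CycleThrough e) → w ∈ verts (path C) → Joins G g w z →
        EdgeOnCycleThrough e g
  ear {e} {w} {z} {g} C w∈P j with g ≟ᶠ e
  ... | yes refl = C , inj₁ refl
  ... | no g≢e =
    cycleThrough (Rerouted.path rerouted) (closing C) (Rerouted.distinct rerouted) e∉rerouted ,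
    inj₂ (Rerouted.detour-inside rerouted (here refl))
    where
      P : Walk (CycleThrough.x C) (CycleThrough.y C)
      P = path C
      entry : EntryPath (λ v → v ≢ w) (verts P) z
      entry with anotherVertex C w
      ... | a , a∈P , a≢w =
        firstEntry (verts P) (connectedWithout w z a (λ z≡w → joins-distinct j (sym z≡w)) a≢w) a∈P
      open EntryPath entry renaming (distinct to walk-distinct)
      detour : Walk w target
      detour = cons g j walk
      rerouted : Rerouted P detour
      rerouted = reroute P detour (distinct C) ((λ w∈ → inside w∈ refl) ∷ walk-distinct)
        (λ w≡y → inside (end∈ walk) (sym w≡y)) w∈P target∈S
        (λ { (here refl) _ → inj₁ refl ; (there m) x∈P → inj₂ (meetsOnlyAtEnd m x∈P) })
      e∉rerouted : e ∉ edges (Rerouted.path rerouted)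
      e∉rerouted m with Rerouted.edges-from rerouted m | cycleEdgeEnds∈verts C (inj₁ refl)
      ... | inj₁ e∈P            | _ = e∉path C e∈P
      ... | inj₂ (here e≡g)     | _ = g≢e (sym e≡g)
      ... | inj₂ (there e∈walk) | e₁∈P , e₂∈P = chord∉entry entry e₁∈P e₂∈P e∈walk

  joined∈ : ∀ {h u v} {L : List V} → Joins G h u v →
            proj₁ (ends G h) ∈ L × proj₂ (ends G h) ∈ L → v ∈ L
  joined∈ {L = L} j (m₁ , m₂) with joins-ends j
  ... | inj₁ (_ , e₂) = subst (_∈ L) e₂ m₂
  ... | inj₂ (e₁ , _) = subst (_∈ L) e₁ m₁

  VertexOnCycleThrough : E → V → Set
  VertexOnCycleThrough e w = Σ (CycleThrough e) λ C → w ∈ verts (path C)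

  -- By the ear lemma, being on a cycle through e spreads along edges ...
  spreadAlongEdge : ∀ {e h u v} → VertexOnCycleThrough e u → Joins G h u v →
                    VertexOnCycleThrough e v
  spreadAlongEdge (C , u∈C) j with ear C u∈C j
  ... | C' , h-on-C' = C' , joined∈ j (cycleEdgeEnds∈verts C' h-on-C')

  -- ... hence along walks, and so to every vertex of the connected graph.
  spreadAlongReach : ∀ {e R u w} → Reach G R u w → VertexOnCycleThrough e u →
                     VertexOnCycleThrough e w
  spreadAlongReach (here _) on = on
  spreadAlongReach (step h _ j r) on = spreadAlongReach r (spreadAlongEdge on j)

  -- Given one cycle through e, every edge g lies on a cycle through e: an end
  -- of g is on such a cycle, and the ear lemma applies to g there.
  everyEdgeOnCycleThrough : ∀ {e} → CycleThrough e → ∀ g → EdgeOnCycleThrough e g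
  everyEdgeOnCycleThrough C g with spreadAlongReach
    (connected (CycleThrough.x C) (proj₁ (ends G g)) tt tt) (C , start∈ (path C))
  ... | C' , g₁∈C' = ear C' g₁∈C' (inj₁ refl)

  commonCycle : ∀ {e₀} → CycleThrough e₀ → ∀ e f → EdgeOnCycleThrough e f
  commonCycle C₀ e f with everyEdgeOnCycleThrough C₀ e
  ... | C , e-on-C = everyEdgeOnCycleThrough (rotate C e-on-C) f

module ColourBounds (G : Multigraph) {t : ℕ} (col : IntervalColoring G t) where
  open IntervalColoring col
  open Walks G
  open CyclesThroughEdges G
  open Degrees G
  open Colouring col

  Δ-1 : ℕ
  Δ-1 = maxDeg G ∸ 1

  -- Along a walk with ℓ edges, from an edge g₁ at its start to an edge g₂ at
  -- its end the colour grows by at most (ℓ + 1)(Δ − 1): one adjacentGap per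
  -- vertex of the walk.
  walkDrift : ∀ {u w g₁ g₂} (p : Walk u w) → Inc G u g₁ → Inc G w g₂ →
              α g₂ ≤ α g₁ + suc (length (edges p)) * Δ-1
  walkDrift {g₁ = g₁} {g₂} (nil _) u-g₁ u-g₂ =
    subst (λ d → α g₂ ≤ α g₁ + d) (sym (+-identityʳ Δ-1)) (adjacentGap u-g₁ u-g₂)
  walkDrift {g₁ = g₁} {g₂} (cons h j p) u-g₁ w-g₂ = begin
    α g₂
      ≤⟨ walkDrift p (proj₂ (joins-inc j)) w-g₂ ⟩
    α h + suc (length (edges p)) * Δ-1
      ≤⟨ +-monoˡ-≤ _ (adjacentGap u-g₁ (proj₁ (joins-inc j))) ⟩
    α g₁ + Δ-1 + suc (length (edges p)) * Δ-1
      ≡⟨ +-assoc (α g₁) Δ-1 _ ⟩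
    α g₁ + suc (length (edges (cons h j p))) * Δ-1 ∎
    where open ≤-Reasoning

  -- On a cycle through e whose path has ℓ edges, an edge f splits the cycle
  -- into two arcs from e to f with a + b = ℓ + 1 inner vertices in total, and
  -- walking along either arc bounds the colour of f.
  cycleDrift : ∀ {e f} (C : CycleThrough e) → OnCycle C f →
    Σ ℕ λ a → Σ ℕ λ b → a + b ≡ cycleLength C ×
      α f ≤ α e + a * Δ-1 × α f ≤ α e + b * Δ-1
  cycleDrift {e} C (inj₁ refl) = 0 , _ , refl , m≤m+n (α e) 0 , m≤m+n (α e) _
  cycleDrift {e} {f} (cycleThrough P closing _ _) (inj₂ f∈P) with splitAtEdge P f∈P
  ... | s , t , p₁ , j , p₂ , refl =
    suc (length (edges p₁)) , suc (length (edges p₂)) , sym arcs ,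
    walkDrift p₁ (proj₂ (joins-inc closing)) (proj₁ (joins-inc j)) ,
    subst (λ ℓ → α f ≤ α e + suc ℓ * Δ-1) length-rev
      (walkDrift (rev p₂) (proj₁ (joins-inc closing)) (proj₂ (joins-inc j)))
    where
      arcs : suc (length (edges (append p₁ (cons f j p₂)))) ≡
             suc (length (edges p₁)) + suc (length (edges p₂))
      arcs = cong suc (trans (cong length (edges-append p₁ _)) (length-++ (edges p₁)))
      length-rev : length (edges (rev p₂)) ≡ length (edges p₂)
      length-rev = trans (cong length (edges-rev p₂)) (length-reverse (edges p₂))

  cycleBound : ∀ {e f c} (C : CycleThrough e) → OnCycle C f →
               cycleLength C ≤ c → α f ≤ α e + (c / 2) * Δ-1
  cycleBound {e} {f} {c} C f-on-C length≤c with cycleDrift C f-on-C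
  ... | a , b , a+b≡ , bound-a , bound-b =
    bound-by-half {a} {b} {c} {α f} {α e} {Δ-1} (subst (_≤ c) (sym a+b≡) length≤c) bound-a bound-b

  -- If any two edges lie on a common cycle of length at most c, then so do
  -- the edges of colours 1 and t, whence t ≤ 1 + ⌊c/2⌋(Δ − 1).
  spanBound : ∀ c → (∀ e f → Σ (CycleThrough e) λ C → OnCycle C f × cycleLength C ≤ c) →
              t ≤ 1 + (c / 2) * Δ-1
  spanBound c common with 1 ≤? t
  ... | no t≱1 = subst (_≤ 1 + (c / 2) * Δ-1) (sym (n<1⇒n≡0 (≰⇒> t≱1))) z≤n
  ... | yes 1≤t with allUsed 1 ≤-refl 1≤t | allUsed t 1≤t ≤-refl
  ...   | e , αe≡1 | f , αf≡t with common e f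
  ...     | C , f-on-C , short =
    subst₂ (λ a b → a ≤ b + (c / 2) * Δ-1) αf≡t αe≡1 (cycleBound C f-on-C short)

open CyclesThroughEdges using (CycleThrough; OnCycle; cycleLength; fromCycleOfLength; toCycleOfLength)
open CommonCycles using (commonCycle)
open ColourBounds using (spanBound)

-- A longest cycle exists, so any two edges lie on a common cycle, whose
-- length is at most the circumference; spanBound concludes.
mainTheorem11 : (G : Multigraph) → TwoConnected G → HasIntervalColoring G →
    (c : ℕ) → IsCircumference G c →
    (t : ℕ) → IntervalColoring G t → t ≤ 1 + (c / 2) * (maxDeg G ∸ 1)
mainTheorem11 G 2conn _ zero (() , _) t col
mainTheorem11 G 2conn _ (suc k) (longest , maximal) t col = spanBound G col (suc k) common
  where
    common : ∀ e f → Σ (CycleThrough G e) λ C → OnCycle G C f × cycleLength G C ≤ suc k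
    common e f =
      let C , f-on-C = commonCycle G 2conn (proj₂ (fromCycleOfLength G longest)) e f
      in C , f-on-C , maximal (cycleLength G C) (toCycleOfLength G C)
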